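{- Let $F$ be a $2$-graph and let $r\ge 3$ be an integer. Then for all sufficiently large $n$ (i.e. $1/n\ll r$) the following holds. Consider any edge-coloring of $K_n^r$ such that $K_n^r$ contains no rainbow copy of $F^{(r)}$. Then for every $H\in\mathcal F^-=\{F-e: e\in F\}$ and every rainbow collection $\mathbf{\mathcal H}$ of $H^{(r)}$ in $K_n^r$, we have $|\mathbf{\mathcal H}|\le\binom{n}{2}$.
   Context: An $r$-graph is identified with its edge set; $K_n^r=\binom{[n]}{r}$. For an edge-coloring $C$ of $K_n^r$ and a subgraph $H$, $C(H)=\{C(e):e\in H\}$; $H$ is rainbow if no two of its edges have the same color. For a $2$-graph $F$, the expansion $F^{(r)}$ is the $r$-graph on $|V(F)|+(r-2)|F|$ vertices obtained by adding to each edge of $F$ a set of $r-2$ new vertices (distinct new vertices for distinct edges); $F-e$ is $F$ with edge $e$ removed. Given an edge-colored $K_n^r$ and an $r$-graph $H'$, a rainbow collection of $H'$ in $K_n^r$ is a collection $\mathbf{\mathcal H}$ of rainbow subgraphs of $K_n^r$, each isomorphic to $H'$, such that $C(H_1)\cap C(H_2)=\emptyset$ for any two distinct members $H_1,H_2\in\mathbf{\mathcal H}$. -}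

module Defs where

open import Data.Nat using (ℕ; zero; suc; pred; _∸_)
open import Data.Fin using (Fin; punchIn)
open import Data.Fin.Subset using (Subset; ⁅_⁆; _∪_; ⊥)
open import Data.List using (List; []; _∷_; map; foldr; allFin)
open import Data.Product using (_×_; _,_; proj₁; proj₂; Σ; ∃)
open import Data.Sum using (_⊎_; inj₁; inj₂)
open import Relation.Binary.PropositionalEquality using (_≡_; _≢_)
open import Relation.Nullary using (¬_)
open import Function.Definitions using (Injective)

SamePair : ∀ {v} → Fin v × Fin v → Fin v × Fin v → Set
SamePair (a , b) (c , d) = (a ≡ c × b ≡ d) ⊎ (a ≡ d × b ≡ c)

-- A (simple, finite) 2-graph on vertex set Fin v with k edges,
-- edge i being the unordered pair {proj₁ (ends i), proj₂ (ends i)}.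
record Graph2 : Set where
  field
    v        : ℕ
    k        : ℕ
    ends     : Fin k → Fin v × Fin v
    loopless : ∀ i → proj₁ (ends i) ≢ proj₂ (ends i)
    simple   : ∀ i j → SamePair (ends i) (ends j) → i ≡ j
open Graph2 public

removeEdge : ∀ {k} {X : Set} → (Fin k → X) → Fin k → Fin (pred k) → X
removeEdge {suc k} ends e i = ends (punchIn e i)

-- Vertex set of the expansion G^(r) of a 2-graph with v vertices and k edges:
-- the old vertices, plus r-2 new vertices for each edge.
ExpV : ℕ → ℕ → ℕ → Set
ExpV r v k = Fin v ⊎ (Fin k × Fin (r ∸ 2))

expEdge : ∀ r {v k} → (Fin k → Fin v × Fin v) → Fin k → List (ExpV r v k)
expEdge r ends i =
  inj₁ (proj₁ (ends i)) ∷ inj₁ (proj₂ (ends i)) ∷ map (λ j → inj₂ (i , j)) (allFin (r ∸ 2))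

imageSet : ∀ {A : Set} {n} → (A → Fin n) → List A → Subset n
imageSet φ = foldr (λ x S → ⁅ φ x ⁆ ∪ S) ⊥

record Copy (r : ℕ) {v k : ℕ} (ends : Fin k → Fin v × Fin v) (n : ℕ) : Set where
  field
    φ   : ExpV r v k → Fin n
    inj : Injective _≡_ _≡_ φ
open Copy public

copyEdge : ∀ {r v k} {ends : Fin k → Fin v × Fin v} {n} → Copy r ends n → Fin k → Subset n
copyEdge {r} {ends = ends} H i = imageSet (φ H) (expEdge r ends i)

-- Rainbow: distinct edges get distinct colors. The colouring of K_n^r is
-- given as c : Subset n → C; only its values on r-subsets are ever used.
Rainbow : ∀ {C : Set} {n r v k} {ends : Fin k → Fin v × Fin v} →
          (Subset n → C) → Copy r ends n → Set
Rainbow c H = ∀ i j → c (copyEdge H i) ≡ c (copyEdge H j) → i ≡ j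

HasRainbowCopy : ∀ {C : Set} {n} r {v k} → (Fin k → Fin v × Fin v) → (Subset n → C) → Set
HasRainbowCopy {n = n} r ends c = Σ (Copy r ends n) (Rainbow c)

SameEdgeSet : ∀ {n r v k} {ends : Fin k → Fin v × Fin v} → Copy r ends n → Copy r ends n → Set
SameEdgeSet H H' = (∀ i → ∃ λ i' → copyEdge H i ≡ copyEdge H' i')
                 × (∀ i' → ∃ λ i → copyEdge H' i' ≡ copyEdge H i)

RainbowCollection : ∀ {C : Set} {n r v k} {ends : Fin k → Fin v × Fin v} {m} →
                    (Subset n → C) → (Fin m → Copy r ends n) → Set
RainbowCollection c 𝓗 =
    (∀ t → Rainbow c (𝓗 t))
  × (∀ t t' → t ≢ t' → ¬ SameEdgeSet (𝓗 t) (𝓗 t'))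
  × (∀ t t' → t ≢ t' → ∀ i i' → c (copyEdge (𝓗 t) i) ≢ c (copyEdge (𝓗 t') i'))

-- Let 𝓗 be a rainbow collection of (F − e)^(r) and send each member H to the
-- image {x_H, y_H} of the two endpoints of e. This map is injective, whence
-- |𝓗| ≤ C(n, 2). Indeed, if two members H ≠ H′ shared {x, y}, choose r − 2
-- vertices outside both copies and let S be the r-set they form with x and y.
-- Adding S as the missing edge turns H into a copy of F^(r); as there is no
-- rainbow copy, the colour of S already occurs on H. The same holds for H′,
-- so the colour sets of H and H′ meet, contradicting disjointness.
module Submission where

open import Defs
open import Data.Nat using (ℕ; zero; suc; pred; _+_; _*_; _∸_; _≤_; _<_)
open import Data.Nat.Properties using (+-suc; m+n≤o⇒m≤o; <⇒≱)
open import Data.Nat.Combinatorics using (_C_; nC1≡n; nCk+nC[k+1]≡[n+1]C[k+1])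
open import Data.Fin using (Fin; zero; suc; join; splitAt; punchIn; punchOut)
open import Data.Fin.Properties
  using (_≟_; splitAt-join; injective⇒≤; ¬∀⟶∃¬; any?; +↔⊎; *↔×;
         punchInᵢ≢i; punchIn-punchOut; punchOut-punchIn;
         punchOut-cong; punchOut-injective)
open import Data.Fin.Subset using (Subset; ⁅_⁆; _∪_)
open import Data.Fin.Subset.Properties using (∪-comm; ∪-assoc)
open import Data.Vec.Functional as Vector using ()
open import Data.List using ([]; _∷_; map; allFin)
open import Data.List.Properties using (foldr-map)
open import Data.Product.Properties using (,-injectiveˡ; ,-injectiveʳ)
open import Data.Product using (_×_; _,_; proj₁; proj₂; Σ-syntax; ∃)
open import Data.Sum using (_⊎_; inj₁; inj₂; [_,_]′; map₂)
open import Data.Sum.Properties using (inj₁-injective; inj₂-injective)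
open import Data.Sum.Function.Propositional using (_⊎-↔_)
open import Data.Empty using (⊥; ⊥-elim)
open import Relation.Binary.PropositionalEquality
open import Relation.Binary.PropositionalEquality.Properties using (subst-injective)
open import Relation.Nullary using (¬_; yes; no)
open import Function using (_∘_; _$_; Inverse; _↔_)
open import Function.Definitions using (Injective)
open import Function.Properties.Inverse using (↔-refl; ↔-trans)

private
  variable
    n : ℕ

-- A 2-subset of Fin (suc n) either contains zero (inj₁ y stands for
-- {zero, suc y}) or is the shift of a 2-subset of Fin n.
TwoSubset : ℕ → Set
TwoSubset zero    = ⊥
TwoSubset (suc n) = Fin n ⊎ TwoSubset n

toTwoSubset : (x y : Fin n) → x ≢ y → TwoSubset n
toTwoSubset zero    zero    x≢y = ⊥-elim (x≢y refl)
toTwoSubset zero    (suc y) _   = inj₁ y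
toTwoSubset (suc x) zero    _   = inj₁ x
toTwoSubset (suc x) (suc y) x≢y = inj₂ (toTwoSubset x y (x≢y ∘ cong suc))

SamePair-suc : {x y x′ y′ : Fin n} → SamePair (x , y) (x′ , y′) →
               SamePair {suc n} (suc x , suc y) (suc x′ , suc y′)
SamePair-suc (inj₁ (x≡x′ , y≡y′)) = inj₁ (cong suc x≡x′ , cong suc y≡y′)
SamePair-suc (inj₂ (x≡y′ , y≡x′)) = inj₂ (cong suc x≡y′ , cong suc y≡x′)

toTwoSubset-injective : (x y x′ y′ : Fin n) (x≢y : x ≢ y) (x′≢y′ : x′ ≢ y′) →
                        toTwoSubset x y x≢y ≡ toTwoSubset x′ y′ x′≢y′ →
                        SamePair (x , y) (x′ , y′)
toTwoSubset-injective zero zero _ _ x≢y _ _ = ⊥-elim (x≢y refl)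
toTwoSubset-injective _ _ zero zero _ x′≢y′ _ = ⊥-elim (x′≢y′ refl)
toTwoSubset-injective zero    (suc y) zero     (suc y′) _ _ eq = inj₁ (refl , cong suc (inj₁-injective eq))
toTwoSubset-injective zero    (suc y) (suc x′) zero     _ _ eq = inj₂ (refl , cong suc (inj₁-injective eq))
toTwoSubset-injective (suc x) zero    zero     (suc y′) _ _ eq = inj₂ (cong suc (inj₁-injective eq) , refl)
toTwoSubset-injective (suc x) zero    (suc x′) zero     _ _ eq = inj₁ (cong suc (inj₁-injective eq) , refl)
toTwoSubset-injective zero    (suc y) (suc x′) (suc y′) _ _ ()
toTwoSubset-injective (suc x) zero    (suc x′) (suc y′) _ _ ()
toTwoSubset-injective (suc x) (suc y) zero     (suc y′) _ _ ()
toTwoSubset-injective (suc x) (suc y) (suc x′) zero     _ _ ()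
toTwoSubset-injective (suc x) (suc y) (suc x′) (suc y′) _ _ eq =
  SamePair-suc (toTwoSubset-injective x y x′ y′ _ _ (inj₂-injective eq))

[1+n]C2≡n+nC2 : ∀ n → suc n C 2 ≡ n + n C 2
[1+n]C2≡n+nC2 n = begin
  suc n C 2      ≡⟨ nCk+nC[k+1]≡[n+1]C[k+1] n 1 ⟨
  n C 1 + n C 2  ≡⟨ cong (_+ n C 2) (nC1≡n n) ⟩
  n + n C 2      ∎
  where open ≡-Reasoning

join-injective : ∀ m n → Injective _≡_ _≡_ (join m n)
join-injective m n {i} {j} eq = begin
  i                     ≡⟨ splitAt-join m n i ⟨
  splitAt m (join m n i) ≡⟨ cong (splitAt m) eq ⟩
  splitAt m (join m n j) ≡⟨ splitAt-join m n j ⟩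
  j                     ∎
  where open ≡-Reasoning

embed : Fin n ⊎ Fin (n C 2) → Fin (suc n C 2)
embed {n} = subst Fin (sym ([1+n]C2≡n+nC2 n)) ∘ join n (n C 2)

embed-injective : Injective _≡_ _≡_ (embed {n})
embed-injective {n} = join-injective n (n C 2) ∘ subst-injective (sym ([1+n]C2≡n+nC2 n))

encode : TwoSubset n → Fin (n C 2)
encode {suc n} = embed ∘ map₂ encode

encode-injective : Injective _≡_ _≡_ (encode {n})
encode-injective {suc n} {inj₁ x} {inj₁ y} eq = cong inj₁ (inj₁-injective (embed-injective {n} eq))
encode-injective {suc n} {inj₂ s} {inj₂ t} eq = cong inj₂ (encode-injective (inj₂-injective (embed-injective {n} eq)))
encode-injective {suc n} {inj₁ x} {inj₂ t} eq with () ← embed-injective {n} {inj₁ x} {inj₂ (encode t)} eq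
encode-injective {suc n} {inj₂ s} {inj₁ y} eq with () ← embed-injective {n} {inj₂ (encode s)} {inj₁ y} eq

pairCode : (p : Fin n × Fin n) → proj₁ p ≢ proj₂ p → Fin (n C 2)
pairCode (x , y) x≢y = encode (toTwoSubset x y x≢y)

pairCode-injective : ∀ (p q : Fin n × Fin n) p₁≢p₂ q₁≢q₂ →
                     pairCode p p₁≢p₂ ≡ pairCode q q₁≢q₂ → SamePair p q
pairCode-injective (x , y) (x′ , y′) x≢y x′≢y′ =
  toTwoSubset-injective x y x′ y′ x≢y x′≢y′ ∘ encode-injective

freshPoint : ∀ {N} (h : Fin N → Fin n) → N < n → ∃ λ x → ∀ a → h a ≢ x
freshPoint {n} h N<n =
  let x , x∉image = ¬∀⟶∃¬ n (λ x → ∃ λ a → h a ≡ x) (λ x → any? (λ a → h a ≟ x)) h-not-onto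
  in  x , λ a ha≡x → x∉image (a , ha≡x)
  where
  h-not-onto : ¬ (∀ x → ∃ λ a → h a ≡ x)
  h-not-onto onto = <⇒≱ N<n (injective⇒≤ {f = proj₁ ∘ onto} λ {x} {y} eq →
    trans (sym (proj₂ (onto x))) (trans (cong h eq) (proj₂ (onto y))))

freshInjection : ∀ {N} s (h : Fin N → Fin n) → N + s ≤ n →
  Σ[ g ∈ (Fin s → Fin n) ] Injective _≡_ _≡_ g × (∀ j a → g j ≢ h a)
freshInjection zero h _ = (λ ()) , (λ { {()} }) , (λ ())
freshInjection {n} {N} (suc s) h N+[1+s]≤n
  with 1+N+s≤n ← subst (_≤ n) (+-suc N s) N+[1+s]≤n
  with x , x-fresh ← freshPoint h (m+n≤o⇒m≤o (suc N) 1+N+s≤n)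
  with g , g-injective , g-fresh ← freshInjection s (x Vector.∷ h) 1+N+s≤n
  = x Vector.∷ g , injective , fresh
  where
  injective : Injective _≡_ _≡_ (x Vector.∷ g)
  injective {zero}  {zero}  _  = refl
  injective {zero}  {suc j} eq = ⊥-elim (g-fresh j zero (sym eq))
  injective {suc i} {zero}  eq = ⊥-elim (g-fresh i zero eq)
  injective {suc i} {suc j} eq = cong suc (g-injective eq)
  fresh : ∀ j a → (x Vector.∷ g) j ≢ h a
  fresh zero    a eq = x-fresh a (sym eq)
  fresh (suc j) a    = g-fresh j (suc a)

freshInjection-↔ : ∀ {A : Set} {N} s → Fin N ↔ A → (h : A → Fin n) → N + s ≤ n →
  Σ[ g ∈ (Fin s → Fin n) ] Injective _≡_ _≡_ g × (∀ j a → g j ≢ h a)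
freshInjection-↔ s Fin↔A h N+s≤n
  with g , g-injective , g-fresh ← freshInjection s (h ∘ Inverse.to Fin↔A) N+s≤n
  = g , g-injective , λ j a eq →
    g-fresh j (Inverse.from Fin↔A a) (trans eq (cong h (sym (Inverse.strictlyInverseˡ Fin↔A a))))

[,]-injective : ∀ {A B C : Set} {f : A → C} {g : B → C} →
                Injective _≡_ _≡_ f → Injective _≡_ _≡_ g → (∀ a b → f a ≢ g b) →
                Injective _≡_ _≡_ [ f , g ]′
[,]-injective f-inj g-inj f≢g {inj₁ a} {inj₁ a′} eq = cong inj₁ (f-inj eq)
[,]-injective f-inj g-inj f≢g {inj₁ a} {inj₂ b}  eq = ⊥-elim (f≢g a b eq)
[,]-injective f-inj g-inj f≢g {inj₂ b} {inj₁ a}  eq = ⊥-elim (f≢g a b (sym eq))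
[,]-injective f-inj g-inj f≢g {inj₂ b} {inj₂ b′} eq = cong inj₂ (g-inj eq)

data PunchView {k} (e : Fin (suc k)) : Fin (suc k) → Set where
  at     : PunchView e e
  beside : ∀ i → PunchView e (punchIn e i)

punchView : ∀ {k} (e i : Fin (suc k)) → PunchView e i
punchView e i with e ≟ i
... | yes refl = at
... | no  e≢i  = subst (PunchView e) (punchIn-punchOut e≢i) (beside (punchOut e≢i))

expSize : ℕ → ℕ → ℕ → ℕ
expSize r v k = v + k * (r ∸ 2)

Fin↔ExpV : ∀ r v k → Fin (expSize r v k) ↔ ExpV r v k
Fin↔ExpV r v k = ↔-trans +↔⊎ (↔-refl ⊎-↔ *↔×)

-- The vertices of F^(r) are the r − 2 new vertices of the edge e together
-- with the vertices of (F − e)^(r).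
splitVertex : ∀ {r v k} (e : Fin (suc k)) → ExpV r v (suc k) → Fin (r ∸ 2) ⊎ ExpV r v k
splitVertex e (inj₁ x) = inj₂ (inj₁ x)
splitVertex e (inj₂ (i , j)) with e ≟ i
... | yes _   = inj₁ j
... | no  e≢i = inj₂ (inj₂ (punchOut e≢i , j))

splitVertex-new : ∀ {r v k} (e : Fin (suc k)) j →
                  splitVertex {r} {v} e (inj₂ (e , j)) ≡ inj₁ j
splitVertex-new e j with e ≟ e
... | yes _   = refl
... | no  e≢e = ⊥-elim (e≢e refl)

splitVertex-punchIn : ∀ {r v k} (e : Fin (suc k)) i j →
                      splitVertex {r} {v} e (inj₂ (punchIn e i , j)) ≡ inj₂ (inj₂ (i , j))
splitVertex-punchIn e i j with e ≟ punchIn e i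
... | yes e≡e↑i = ⊥-elim (punchInᵢ≢i e i (sym e≡e↑i))
... | no  e≢e↑i = cong (λ i′ → inj₂ (inj₂ (i′ , j))) (trans (punchOut-cong e refl) (punchOut-punchIn e))

splitVertex-injective : ∀ {r v k} (e : Fin (suc k)) → Injective _≡_ _≡_ (splitVertex {r} {v} e)
splitVertex-injective e {inj₁ x} {inj₁ y} eq = cong inj₁ (inj₁-injective (inj₂-injective eq))
splitVertex-injective e {inj₁ x} {inj₂ (i , j)} eq with e ≟ i
... | yes _ with () ← eq
... | no  _ with () ← eq
splitVertex-injective e {inj₂ (i , j)} {inj₁ y} eq with e ≟ i
... | yes _ with () ← eq
... | no  _ with () ← eq
splitVertex-injective e {inj₂ (i , j)} {inj₂ (i′ , j′)} eq with e ≟ i | e ≟ i′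
... | yes refl | yes refl = cong (λ j → inj₂ (e , j)) (inj₁-injective eq)
... | yes _    | no  _    with () ← eq
... | no  _    | yes _    with () ← eq
... | no  e≢i  | no  e≢i′ = cong₂ (λ i j → inj₂ (i , j))
  (punchOut-injective e≢i e≢i′ (,-injectiveˡ (inj₂-injective (inj₂-injective eq))))
  (,-injectiveʳ (inj₂-injective (inj₂-injective eq)))

imageSet-cong : ∀ {A : Set} {f g : A → Fin n} → (∀ x → f x ≡ g x) → ∀ xs →
                imageSet f xs ≡ imageSet g xs
imageSet-cong f≗g []       = refl
imageSet-cong f≗g (x ∷ xs) = cong₂ (λ y S → ⁅ y ⁆ ∪ S) (f≗g x) (imageSet-cong f≗g xs)

imageSet-map : ∀ {A B : Set} (f : B → Fin n) (g : A → B) xs →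
               imageSet f (map g xs) ≡ imageSet (f ∘ g) xs
imageSet-map f g = foldr-map _ g _

addPair : Fin n × Fin n → Subset n → Subset n
addPair (x , y) S = ⁅ x ⁆ ∪ (⁅ y ⁆ ∪ S)

addPair-cong : ∀ {p q : Fin n × Fin n} S → SamePair p q → addPair p S ≡ addPair q S
addPair-cong S (inj₁ (refl , refl)) = refl
addPair-cong {p = x , y} S (inj₂ (refl , refl)) = begin
  ⁅ x ⁆ ∪ (⁅ y ⁆ ∪ S)  ≡⟨ ∪-assoc ⁅ x ⁆ ⁅ y ⁆ S ⟨
  (⁅ x ⁆ ∪ ⁅ y ⁆) ∪ S  ≡⟨ cong (_∪ S) (∪-comm ⁅ x ⁆ ⁅ y ⁆) ⟩
  (⁅ y ⁆ ∪ ⁅ x ⁆) ∪ S  ≡⟨ ∪-assoc ⁅ y ⁆ ⁅ x ⁆ S ⟩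
  ⁅ y ⁆ ∪ (⁅ x ⁆ ∪ S)  ∎
  where open ≡-Reasoning

anchor : ∀ {r v k} (ends : Fin k → Fin v × Fin v) (e : Fin k) →
         Copy r (removeEdge ends e) n → Fin n × Fin n
anchor ends e H = φ H (inj₁ (proj₁ (ends e))) , φ H (inj₁ (proj₂ (ends e)))

-- Completing a copy of (F − e)^(r) to a copy of F^(r)

module Completion {r v k} (ends : Fin (suc k) → Fin v × Fin v) (e : Fin (suc k))
  (H : Copy r (removeEdge ends e) n) (g : Fin (r ∸ 2) → Fin n) where

  newEdge : Subset n
  newEdge = addPair (anchor ends e H) (imageSet g (allFin (r ∸ 2)))

  module _ (g-injective : Injective _≡_ _≡_ g) (g-fresh : ∀ j x → g j ≢ φ H x) where

    complete : Copy r ends n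
    complete = record
      { φ   = [ g , φ H ]′ ∘ splitVertex {r} e
      ; inj = splitVertex-injective {r} e ∘ [,]-injective g-injective (inj H) g-fresh
      }

    copyEdge-complete-e : copyEdge complete e ≡ newEdge
    copyEdge-complete-e = cong (addPair (anchor ends e H)) (begin
      imageSet (φ complete) (map (λ j → inj₂ (e , j)) (allFin (r ∸ 2)))
        ≡⟨ imageSet-map (φ complete) _ (allFin (r ∸ 2)) ⟩
      imageSet (λ j → φ complete (inj₂ (e , j))) (allFin (r ∸ 2))
        ≡⟨ imageSet-cong (λ j → cong [ g , φ H ]′ (splitVertex-new {r} e j)) (allFin (r ∸ 2)) ⟩
      imageSet g (allFin (r ∸ 2))
        ∎)
      where open ≡-Reasoning

    copyEdge-complete-punchIn : ∀ i → copyEdge complete (punchIn e i) ≡ copyEdge H i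
    copyEdge-complete-punchIn i = cong (addPair _) (begin
      imageSet (φ complete) (map (λ j → inj₂ (punchIn e i , j)) (allFin (r ∸ 2)))
        ≡⟨ imageSet-map (φ complete) _ (allFin (r ∸ 2)) ⟩
      imageSet (λ j → φ complete (inj₂ (punchIn e i , j))) (allFin (r ∸ 2))
        ≡⟨ imageSet-cong (λ j → cong [ g , φ H ]′ (splitVertex-punchIn {r} e i j)) (allFin (r ∸ 2)) ⟩
      imageSet (λ j → φ H (inj₂ (i , j))) (allFin (r ∸ 2))
        ≡⟨ imageSet-map (φ H) _ (allFin (r ∸ 2)) ⟨
      imageSet (φ H) (map (λ j → inj₂ (i , j)) (allFin (r ∸ 2)))
        ∎)
      where open ≡-Reasoning

    module _ {Col : Set} (c : Subset n → Col) where

      complete-rainbow : Rainbow c H → (∀ i → c newEdge ≢ c (copyEdge H i)) →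
                         Rainbow c complete
      complete-rainbow H-rainbow newColour = rainbow
        where
        colour-punchIn : ∀ i → c (copyEdge complete (punchIn e i)) ≡ c (copyEdge H i)
        colour-punchIn = cong c ∘ copyEdge-complete-punchIn

        newEdge-colour-unique : ∀ i → c (copyEdge complete e) ≢ c (copyEdge complete (punchIn e i))
        newEdge-colour-unique i same = newColour i
          (trans (cong c (sym copyEdge-complete-e)) (trans same (colour-punchIn i)))

        rainbow : Rainbow c complete
        rainbow i j same with punchView e i | punchView e j
        ... | at        | at        = refl
        ... | at        | beside j′ = ⊥-elim (newEdge-colour-unique j′ same)
        ... | beside i′ | at        = ⊥-elim (newEdge-colour-unique i′ (sym same))
        ... | beside i′ | beside j′ = cong (punchIn e) (H-rainbow i′ j′
          (trans (sym (colour-punchIn i′)) (trans same (colour-punchIn j′))))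

      newEdge-colour-reused : Rainbow c H → ¬ HasRainbowCopy r ends c →
                              ¬ (∀ i → c newEdge ≢ c (copyEdge H i))
      newEdge-colour-reused H-rainbow no-copy newColour =
        no-copy (complete , complete-rainbow H-rainbow newColour)

threshold : ℕ → ℕ → ℕ → ℕ
threshold r v k = (expSize r v (pred k) + expSize r v (pred k)) + (r ∸ 2)

anchor-distinct : ∀ {r v k} (ends : Fin k → Fin v × Fin v) →
                  (∀ i → proj₁ (ends i) ≢ proj₂ (ends i)) →
                  ∀ e (H : Copy r (removeEdge ends e) n) →
                  proj₁ (anchor ends e H) ≢ proj₂ (anchor ends e H)
anchor-distinct ends loopless e H = loopless e ∘ inj₁-injective ∘ inj H

sameAnchor⇒≡ : ∀ {r v k m} {Col : Set} (ends : Fin (suc k) → Fin v × Fin v)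
               (c : Subset n → Col) → threshold r v (suc k) ≤ n →
               ¬ HasRainbowCopy r ends c →
               ∀ e (𝓗 : Fin m → Copy r (removeEdge ends e) n) → RainbowCollection c 𝓗 →
               ∀ t t′ → SamePair (anchor ends e (𝓗 t)) (anchor ends e (𝓗 t′)) → t ≡ t′
sameAnchor⇒≡ {n} {r} {v} {k} ends c n₀≤n no-copy e 𝓗 (rainbow , _ , disjoint) t t′ same
  with t ≟ t′
... | yes t≡t′ = t≡t′
... | no  t≢t′
  with g , g-injective , g-fresh ←
    freshInjection-↔ (r ∸ 2) (↔-trans +↔⊎ (Fin↔ExpV r v k ⊎-↔ Fin↔ExpV r v k))
                     [ φ (𝓗 t) , φ (𝓗 t′) ]′ n₀≤n
  = ⊥-elim $ reused-in t (λ i → g-fresh i ∘ inj₁) λ i colour-i →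
    reused-in t′ (λ i → g-fresh i ∘ inj₂) λ i′ colour-i′ →
    disjoint t t′ t≢t′ i i′ (begin
      c (copyEdge (𝓗 t) i)   ≡⟨ colour-i ⟨
      c (newEdge (𝓗 t) g)    ≡⟨ cong c (addPair-cong (imageSet g (allFin (r ∸ 2))) same) ⟩
      c (newEdge (𝓗 t′) g)   ≡⟨ colour-i′ ⟩
      c (copyEdge (𝓗 t′) i′) ∎)
  where
  open ≡-Reasoning
  open Completion ends e using (newEdge; newEdge-colour-reused)
  reused-in : ∀ s → (∀ j x → g j ≢ φ (𝓗 s) x) →
              ¬ (∀ i → c (newEdge (𝓗 s) g) ≢ c (copyEdge (𝓗 s) i))
  reused-in s g-fresh-s = newEdge-colour-reused (𝓗 s) g g-injective g-fresh-s c (rainbow s) no-copy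

rainbowCollection-size≤ : ∀ {r v k m} {Col : Set} (ends : Fin k → Fin v × Fin v) →
                          (∀ i → proj₁ (ends i) ≢ proj₂ (ends i)) →
                          (c : Subset n → Col) → threshold r v k ≤ n →
                          ¬ HasRainbowCopy r ends c →
                          ∀ e (𝓗 : Fin m → Copy r (removeEdge ends e) n) →
                          RainbowCollection c 𝓗 → m ≤ n C 2
rainbowCollection-size≤ {n} {k = suc k} {m} ends loopless c n₀≤n no-copy e 𝓗 collection =
  injective⇒≤ {f = code} λ {t} {t′} →
    sameAnchor⇒≡ ends c n₀≤n no-copy e 𝓗 collection t t′ ∘ pairCode-injective _ _ _ _
  where
  code : Fin m → Fin (n C 2)
  code t = pairCode (anchor ends e (𝓗 t)) (anchor-distinct ends loopless e (𝓗 t))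

lemma2p2 : (F : Graph2) (r : ℕ) → 3 ≤ r →
    ∃ λ n₀ → ∀ n → n₀ ≤ n →
      (Col : Set) (c : Subset n → Col) →
      ¬ HasRainbowCopy r (ends F) c →
      (e : Fin (k F)) (m : ℕ) (𝓗 : Fin m → Copy r (removeEdge (ends F) e) n) →
      RainbowCollection c 𝓗 →
      m ≤ n C 2
lemma2p2 F r _ = threshold r (v F) (k F) , λ n n₀≤n Col c no-copy e m 𝓗 →
  rainbowCollection-size≤ (ends F) (loopless F) c n₀≤n no-copy e 𝓗
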